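{- Let $G=(\Gamma,s)$ be a graph with non-sink vertex set $\tilde V$. Every $G$-parking function $p$ admits a prime decomposition, i.e. an ordered set partition $(A_1,\dots,A_k)$ of $\tilde V$ into non-empty blocks such that for every $i\in[k]$ the function $p^{A_i}:A_i\to\mathbb Z$, $p^{A_i}(v):=p(v)-\deg^{\bigcup_{j=1}^{i-1}A_j}(v)$, is a prime $G^{A_i}$-parking function.
   Context: A graph $G=(\Gamma,s)$ is a finite, undirected, connected multigraph (multiple edges allowed, no loops) with vertex set $V$ and distinguished sink $s$; $\tilde V=V\setminus\{s\}$. $\mathrm{mult}(vw)$ is the number of edges between $v,w$; $\deg^A(v)=\sum_{w\in A}\mathrm{mult}(vw)$. $\mathbb N=\{1,2,\dots\}$. For a graph $H$ (finite multigraph without loops, not necessarily connected) with sink $s$, vertex set $V_H$ and non-sink vertex set $\tilde V_H$, an $H$-parking function is $p:\tilde V_H\to\mathbb N$ such that every non-empty $S\subseteq\tilde V_H$ contains $v$ with $p(v)\le\deg_H^{V_H\setminus S}(v)$; $\mathrm{PF}(H)$ is their set. For $A\subseteq\tilde V_H$, $H^A$ is the induced subgraph of $H$ on $A\cup\{s\}$ with sink $s$. For $p\in\mathrm{PF}(H)$ and an ordered partition $(A,B)$ of $\tilde V_H$ with $A,B\neq\emptyset$, set $p^A=p|_A$ and $p^B(v)=p(v)-\deg_H^A(v)$ for $v\in B$; $p$ is decomposable w.r.t. $(A,B)$ if $p^A\in\mathrm{PF}(H^A)$ and $p^B\in\mathrm{PF}(H^B)$; $p$ is prime (a prime $H$-parking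 function) if it is decomposable w.r.t. no such partition. $G^{A}$ is defined as $H^A$ with $H=G$. -}

module Defs where

open import Data.Nat as ℕ using (ℕ; zero; suc; _<_)
open import Data.Integer as ℤ using (ℤ; +_; _-_; _≤_)
open import Data.Fin using (Fin; zero; suc)
open import Data.Fin.Subset using (Subset; _∈_; _⊆_; _─_; _∩_; _∪_; Nonempty; Empty; ⊥; ⊤; inside; outside)
open import Data.Vec using (_∷_; lookup)
open import Data.List using (List; []; _∷_; map; allFin)
open import Data.Nat.ListAction using (sum)
open import Data.Bool using (if_then_else_)
open import Data.Product using (Σ; ∃; _×_; _,_)
open import Relation.Nullary using (¬_)
open import Relation.Binary.PropositionalEquality using (_≡_)

-- Vertex set V = Fin (suc n); the sink s is `zero`; the non-sink vertex
-- i : Fin n is the vertex `suc i`.  mult v w = number of edges between v, w.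
data Reach {n : ℕ} (mult : Fin (suc n) → Fin (suc n) → ℕ) :
           Fin (suc n) → Fin (suc n) → Set where
  here : ∀ {v} → Reach mult v v
  step : ∀ {u v w} → 0 < mult u v → Reach mult v w → Reach mult u w

record Graph (n : ℕ) : Set where
  field
    mult      : Fin (suc n) → Fin (suc n) → ℕ
    mult-sym  : ∀ v w → mult v w ≡ mult w v
    no-loops  : ∀ v → mult v v ≡ 0
    connected : ∀ v w → Reach mult v w

open Graph public

deg : ∀ {n} → Graph n → Subset (suc n) → Fin (suc n) → ℕ
deg {n} G X v = sum (map (λ w → if lookup X w then mult G v w else 0) (allFin (suc n)))

⇑ : ∀ {n} → Subset n → Subset (suc n)
⇑ A = outside ∷ A

⇑s : ∀ {n} → Subset n → Subset (suc n)
⇑s A = inside ∷ A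

-- Every graph H occurring here is an induced subgraph G^A (A ⊆ Ṽ) of G
-- (note (G^A)^B = G^B for B ⊆ A).  Functions on Ṽ_H = A are represented as
-- functions Fin n → ℤ of which only the values on A matter.

-- p ∈ PF(G^A): p(v) ∈ ℕ = {1,2,...} for v ∈ A, and every non-empty S ⊆ A
-- contains v with p(v) ≤ deg_{G^A}^{V_{G^A} ∖ S}(v) = deg_G^{(A ∖ S) ∪ {s}}(v).
IsPF : ∀ {n} → Graph n → Subset n → (Fin n → ℤ) → Set
IsPF G A p =
  (∀ v → v ∈ A → + 1 ≤ p v) ×
  (∀ S → S ⊆ A → Nonempty S →
     ∃ λ v → v ∈ S × p v ≤ + deg G (⇑s (A ─ S)) (suc v))

shift : ∀ {n} → Graph n → Subset n → (Fin n → ℤ) → (Fin n → ℤ)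
shift G B p v = p v - + deg G (⇑ B) (suc v)

IsOrdPartition₂ : ∀ {n} → Subset n → Subset n → Subset n → Set
IsOrdPartition₂ A B C =
  Nonempty B × Nonempty C × Empty (B ∩ C) × B ∪ C ≡ A

-- p ∈ PF(G^A) decomposable w.r.t. (B, C):
-- p^B = p|_B ∈ PF((G^A)^B) = PF(G^B) and p^C ∈ PF(G^C),
-- where p^C(v) = p(v) - deg_{G^A}^B(v) = p(v) - deg_G^B(v).
Decomposable : ∀ {n} → Graph n → Subset n → (Fin n → ℤ) → Subset n → Subset n → Set
Decomposable G A p B C = IsPF G B p × IsPF G C (shift G B p)

IsPrimePF : ∀ {n} → Graph n → Subset n → (Fin n → ℤ) → Set
IsPrimePF G A p =
  IsPF G A p ×
  (∀ B C → IsOrdPartition₂ A B C → ¬ Decomposable G A p B C)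

-- IsPrimeDecompFrom G p U (A_i, ..., A_k): U = A_1 ∪ ... ∪ A_{i-1} is the
-- union of the earlier blocks; each block is non-empty, disjoint from the
-- earlier ones, p^{A_i} = p - deg^U is a prime G^{A_i}-parking function,
-- and the blocks together cover Ṽ.
IsPrimeDecompFrom : ∀ {n} → Graph n → (Fin n → ℤ) → Subset n → List (Subset n) → Set
IsPrimeDecompFrom G p U [] = ∀ v → v ∈ U
IsPrimeDecompFrom G p U (A ∷ As) =
  Nonempty A × Empty (A ∩ U) × IsPrimePF G A (shift G U p) ×
  IsPrimeDecompFrom G p (U ∪ A) As

IsPrimeDecomposition : ∀ {n} → Graph n → (Fin n → ℤ) → List (Subset n) → Set
IsPrimeDecomposition G p As = IsPrimeDecompFrom G p ⊥ As

module Submission where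

-- Induction on the block A: a parking function of G^A (shifted by the earlier
-- blocks U) is either prime, or decomposable along some (B, C) with B, C ⊂ A.
-- Since deg is additive on disjoint sets, shifting by U and then by B is
-- shifting by U ∪ B, so a prime decomposition of the B-part followed by one of
-- the C-part is a prime decomposition of the A-part.  Being prime is
-- decidable, as all its quantifiers range over finite sets.

open import Defs
open import Algebra.Properties.CommutativeSemigroup using (interchange)
open import Data.Bool using (true; false; _∨_; if_then_else_)
import Data.Bool as Bool
open import Data.Empty using (⊥-elim)
open import Data.Fin using (Fin; suc)
open import Data.Fin.Properties using (any?; all?)
open import Data.Fin.Subset using (Subset; _∈_; _⊆_; _⊂_; _∩_; _∪_; _─_; Empty; ⊥; ⊤; outside)
open import Data.Fin.Subset.Properties
  using (_∈?_; _⊆?_; nonempty?; anySubset?; Empty-unique; ∉⊥; ∈⊤;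
         x∈p∩q⁺; x∈p∩q⁻; x∈p∪q⁺; x∈p∪q⁻; p⊆p∪q; q⊆p∪q; ∪-identityʳ; ∪-assoc)
open import Data.Fin.Subset.Induction using (Acc; acc; ⊂-wellFounded)
open import Data.Integer as ℤ using (ℤ)
import Data.Integer.Properties as ℤ
open import Data.List using (List; []; _∷_; _++_; map; allFin)
open import Data.List.Properties using (++-assoc; ++-identityʳ; map-cong)
open import Data.Nat as ℕ using (ℕ)
import Data.Nat.Properties as ℕ
open import Data.Nat.ListAction using (sum)
open import Data.Product using (∃; ∃₂; _×_; _,_; proj₂)
open import Data.Sum using (inj₁; inj₂)
open import Data.Vec using (there; lookup)
open import Data.Vec.Properties using (lookup⇒[]=; lookup-zipWith; lookup-replicate; ≡-dec)
open import Function using (_∘_)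
open import Relation.Nullary using (¬_; Dec; yes; no)
open import Relation.Nullary.Decidable using (_×-dec_; _→-dec_; ¬?; decidable-stable)
open import Relation.Binary.PropositionalEquality

private
  variable
    n : ℕ

allSubset? : {P : Subset n → Set} → (∀ S → Dec (P S)) → Dec (∀ S → P S)
allSubset? P? with anySubset? (λ S → ¬? (P? S))
... | yes (S , ¬PS) = no λ ∀P → ¬PS (∀P S)
... | no ∄¬P = yes λ S → decidable-stable (P? S) (λ ¬PS → ∄¬P (S , ¬PS))

sum-map-+ : ∀ {A : Set} (f g : A → ℕ) (xs : List A) →
  sum (map (λ x → f x ℕ.+ g x) xs) ≡ sum (map f xs) ℕ.+ sum (map g xs)
sum-map-+ f g [] = refl
sum-map-+ f g (x ∷ xs) rewrite sum-map-+ f g xs =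
  interchange ℕ.+-commutativeSemigroup
    (f x) (g x) (sum (map f xs)) (sum (map g xs))

Empty-∩-⊆ˡ : {A B U : Subset n} → B ⊆ A → Empty (A ∩ U) → Empty (B ∩ U)
Empty-∩-⊆ˡ {B = B} {U} B⊆A A∩U=∅ (x , x∈B∩U) =
  let x∈B , x∈U = x∈p∩q⁻ B U x∈B∩U in A∩U=∅ (x , x∈p∩q⁺ (B⊆A x∈B , x∈U))

Empty-∩-comm : {A B : Subset n} → Empty (A ∩ B) → Empty (B ∩ A)
Empty-∩-comm {A = A} {B} A∩B=∅ (x , x∈B∩A) =
  let x∈B , x∈A = x∈p∩q⁻ B A x∈B∩A in A∩B=∅ (x , x∈p∩q⁺ (x∈A , x∈B))

Empty-∩-∪ : {A U B : Subset n} → Empty (A ∩ U) → Empty (A ∩ B) → Empty (A ∩ (U ∪ B))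
Empty-∩-∪ {A = A} {U} {B} A∩U=∅ A∩B=∅ (x , x∈A∩[U∪B]) with x∈p∩q⁻ A (U ∪ B) x∈A∩[U∪B]
... | x∈A , x∈U∪B with x∈p∪q⁻ U B x∈U∪B
...   | inj₁ x∈U = A∩U=∅ (x , x∈p∩q⁺ (x∈A , x∈U))
...   | inj₂ x∈B = A∩B=∅ (x , x∈p∩q⁺ (x∈A , x∈B))

Empty-⇑ : {A : Subset n} → Empty A → Empty (⇑ A)
Empty-⇑ A=∅ (suc x , there x∈A) = A=∅ (x , x∈A)

IsOrdPartition₂⇒⊂ : {A B C : Subset n} → IsOrdPartition₂ A B C → B ⊂ A × C ⊂ A
IsOrdPartition₂⇒⊂ {B = B} {C} ((b , b∈B) , (c , c∈C) , B∩C=∅ , refl) =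
  (p⊆p∪q C , c , q⊆p∪q B C c∈C , λ c∈B → B∩C=∅ (c , x∈p∩q⁺ (c∈B , c∈C))) ,
  (q⊆p∪q B C , b , p⊆p∪q C b∈B , λ b∈C → B∩C=∅ (b , x∈p∩q⁺ (b∈B , b∈C)))

IsOrdPartition₂? : (A B C : Subset n) → Dec (IsOrdPartition₂ A B C)
IsOrdPartition₂? A B C =
  nonempty? B ×-dec nonempty? C ×-dec ¬? (nonempty? (B ∩ C)) ×-dec ≡-dec Bool._≟_ (B ∪ C) A

IsDecomposable : Graph n → Subset n → (Fin n → ℤ) → Set
IsDecomposable G A q = ∃₂ λ B C → IsOrdPartition₂ A B C × Decomposable G A q B C

module _ (G : Graph n) where

  deg-∪ : ∀ X Y v → Empty (X ∩ Y) → deg G (X ∪ Y) v ≡ deg G X v ℕ.+ deg G Y v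
  deg-∪ X Y v X∩Y=∅ = begin
    sum (map (weight (X ∪ Y)) (allFin _))
      ≡⟨ cong sum (map-cong weight-∪ (allFin _)) ⟩
    sum (map (λ w → weight X w ℕ.+ weight Y w) (allFin _))
      ≡⟨ sum-map-+ (weight X) (weight Y) (allFin _) ⟩
    deg G X v ℕ.+ deg G Y v ∎
    where
    open ≡-Reasoning
    weight : Subset _ → Fin _ → ℕ
    weight Z w = if lookup Z w then mult G v w else 0
    weight-∪ : ∀ w → weight (X ∪ Y) w ≡ weight X w ℕ.+ weight Y w
    weight-∪ w rewrite lookup-zipWith _∨_ w X Y with lookup X w in w∈X | lookup Y w in w∈Y
    ... | true  | true  = ⊥-elim (X∩Y=∅ (w , x∈p∩q⁺ (lookup⇒[]= w X w∈X , lookup⇒[]= w Y w∈Y)))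
    ... | true  | false = sym (ℕ.+-identityʳ _)
    ... | false | _     = refl

  deg-⊥ : ∀ v → deg G ⊥ v ≡ 0
  deg-⊥ v = sum-weights (allFin _)
    where
    sum-weights : ∀ ws → sum (map (λ w → if lookup ⊥ w then mult G v w else 0) ws) ≡ 0
    sum-weights [] = refl
    sum-weights (w ∷ ws) rewrite lookup-replicate w outside = sum-weights ws

  shift-⊥ : ∀ q v → shift G ⊥ q v ≡ q v
  shift-⊥ q v = begin
    q v ℤ.- ℤ.+ deg G ⊥ (suc v)  ≡⟨ cong (λ d → q v ℤ.- ℤ.+ d) (deg-⊥ (suc v)) ⟩
    q v ℤ.+ ℤ.0ℤ                 ≡⟨ ℤ.+-identityʳ (q v) ⟩
    q v ∎
    where open ≡-Reasoning

  shift-∪ : ∀ U B q → Empty (U ∩ B) → ∀ v → shift G B (shift G U q) v ≡ shift G (U ∪ B) q v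
  shift-∪ U B q U∩B=∅ v = begin
    q v ℤ.- ℤ.+ a ℤ.- ℤ.+ b           ≡⟨ ℤ.+-assoc (q v) (ℤ.- ℤ.+ a) (ℤ.- ℤ.+ b) ⟩
    q v ℤ.+ (ℤ.- ℤ.+ a ℤ.- ℤ.+ b)     ≡⟨ cong (λ d → q v ℤ.+ d) (ℤ.neg-distrib-+ (ℤ.+ a) (ℤ.+ b)) ⟨
    q v ℤ.- (ℤ.+ a ℤ.+ ℤ.+ b)         ≡⟨ cong (λ d → q v ℤ.- d) (ℤ.pos-+ a b) ⟨
    q v ℤ.- ℤ.+ (a ℕ.+ b)
      ≡⟨ cong (λ d → q v ℤ.- ℤ.+ d) (deg-∪ (⇑ U) (⇑ B) (suc v) (Empty-⇑ U∩B=∅)) ⟨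
    shift G (U ∪ B) q v ∎
    where
    open ≡-Reasoning
    a = deg G (⇑ U) (suc v)
    b = deg G (⇑ B) (suc v)

  IsPF-cong : ∀ A {q r} → (∀ v → q v ≡ r v) → IsPF G A q → IsPF G A r
  IsPF-cong A q≗r (positive , parks) =
    (λ v v∈A → subst (ℤ.+ 1 ℤ.≤_) (q≗r v) (positive v v∈A)) ,
    λ S S⊆A S≠∅ → let v , v∈S , qv≤deg = parks S S⊆A S≠∅
                  in v , v∈S , subst (ℤ._≤ _) (q≗r v) qv≤deg

  IsPF? : ∀ A q → Dec (IsPF G A q)
  IsPF? A q =
    all? (λ v → v ∈? A →-dec ℤ.+ 1 ℤ.≤? q v) ×-dec
    allSubset? (λ S → S ⊆? A →-dec nonempty? S →-dec
      any? (λ v → v ∈? S ×-dec q v ℤ.≤? ℤ.+ deg G (⇑s (A ─ S)) (suc v)))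

  IsDecomposable? : ∀ A q → Dec (IsDecomposable G A q)
  IsDecomposable? A q = anySubset? λ B → anySubset? λ C →
    IsOrdPartition₂? A B C ×-dec IsPF? B q ×-dec IsPF? C (shift G B q)

module _ (G : Graph n) (p : Fin n → ℤ) where

  -- As are the blocks between the earlier blocks U and W ⊇ U: prepending them
  -- turns a prime decomposition continuing after W into one continuing after U.
  PrimeSegment : Subset n → Subset n → List (Subset n) → Set
  PrimeSegment U W As =
    ∀ Bs → IsPrimeDecompFrom G p W Bs → IsPrimeDecompFrom G p U (As ++ Bs)

  PrimeSegment-[] : ∀ {U} → PrimeSegment U U []
  PrimeSegment-[] Bs decomp = decomp

  PrimeSegment-++ : ∀ {U V W As Cs} →
    PrimeSegment U V As → PrimeSegment V W Cs → PrimeSegment U W (As ++ Cs)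
  PrimeSegment-++ {U = U} {As = As} {Cs} segment₁ segment₂ Ds =
    subst (IsPrimeDecompFrom G p U) (sym (++-assoc As Cs Ds))
    ∘ segment₁ (Cs ++ Ds) ∘ segment₂ Ds

  IsPF⇒PrimeSegment : ∀ U A → Acc _⊂_ A → Empty (A ∩ U) → IsPF G A (shift G U p) →
                  ∃ (PrimeSegment U (U ∪ A))
  IsPF⇒PrimeSegment U A (acc smaller) A∩U=∅ pf with nonempty? A
  ... | no A=∅ = [] , subst (λ W → PrimeSegment U W []) (sym U∪A≡U) PrimeSegment-[]
    where
    U∪A≡U : U ∪ A ≡ U
    U∪A≡U = trans (cong (U ∪_) (Empty-unique A=∅)) (∪-identityʳ U)
  ... | yes A≠∅ with IsDecomposable? G A (shift G U p)
  ...   | no indecomposable = A ∷ [] , λ Bs decomp → A≠∅ , A∩U=∅ , (pf , prime) , decomp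
    where
    prime : ∀ B C → IsOrdPartition₂ A B C → ¬ Decomposable G A (shift G U p) B C
    prime B C partition decomposable = indecomposable (B , C , partition , decomposable)
  ...   | yes (B , C , partition@(_ , _ , B∩C=∅ , B∪C≡A) , pfB , pfC) =
    let (B⊂A@(B⊆A , _) , C⊂A@(C⊆A , _)) = IsOrdPartition₂⇒⊂ partition
        B∩U=∅ = Empty-∩-⊆ˡ B⊆A A∩U=∅
        C∩[U∪B]=∅ = Empty-∩-∪ (Empty-∩-⊆ˡ C⊆A A∩U=∅) (Empty-∩-comm B∩C=∅)
        pfC′ = IsPF-cong G C (shift-∪ G U B p (Empty-∩-comm B∩U=∅)) pfC
        As , segmentB = IsPF⇒PrimeSegment U B (smaller B⊂A) B∩U=∅ pfB
        Cs , segmentC = IsPF⇒PrimeSegment (U ∪ B) C (smaller C⊂A) C∩[U∪B]=∅ pfC′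
    in As ++ Cs ,
       subst (λ W → PrimeSegment U W (As ++ Cs)) U∪B∪C≡U∪A (PrimeSegment-++ segmentB segmentC)
    where
    U∪B∪C≡U∪A : (U ∪ B) ∪ C ≡ U ∪ A
    U∪B∪C≡U∪A = trans (∪-assoc U B C) (cong (U ∪_) B∪C≡A)

proposition2p5 : ∀ {n : ℕ} (G : Graph n) (p : Fin n → ℤ) →
    IsPF G ⊤ p → ∃ λ (As : List (Subset n)) → IsPrimeDecomposition G p As
proposition2p5 G p pf =
  let As , segment = IsPF⇒PrimeSegment G p ⊥ ⊤ (⊂-wellFounded ⊤) ⊤∩⊥=∅ pf′
  in As , subst (IsPrimeDecomposition G p) (++-identityʳ As) (segment [] (λ _ → x∈p∪q⁺ (inj₂ ∈⊤)))
  where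
  pf′ : IsPF G ⊤ (shift G ⊥ p)
  pf′ = IsPF-cong G ⊤ (λ v → sym (shift-⊥ G p v)) pf
  ⊤∩⊥=∅ : Empty (⊤ ∩ ⊥)
  ⊤∩⊥=∅ (x , x∈⊤∩⊥) = ∉⊥ (proj₂ (x∈p∩q⁻ ⊤ ⊥ x∈⊤∩⊥))
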